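{- Let $x>1$ be irrational with OCF expansion $[(a_1,e_1),(a_2,e_2),\dots]$, and let $n\ge1$. Let \[ \mathcal F_1=\bigcup_{k=0}^\infty(2k+g,\,2k+1),\quad \mathcal F_2=\bigcup_{k=1}^\infty[2k-1,\,2k),\quad \mathcal F_3=\bigcup_{k=1}^\infty[2k,\,2k+g). \] Then \[ a_n=\begin{cases}\lfloor p_n/p_{n-1}\rfloor+1,& p_n/p_{n-1}\in\mathcal F_1,\\ \lfloor p_n/p_{n-1}\rfloor,& p_n/p_{n-1}\in\mathcal F_2,\\ \lfloor p_n/p_{n-1}\rfloor-1,& p_n/p_{n-1}\in\mathcal F_3,\end{cases}\qquad e_{n-1}=\begin{cases}-1,& p_n/p_{n-1}\in\mathcal F_1,\\ 1,& p_n/p_{n-1}\in\mathcal F_2\cup\mathcal F_3.\end{cases} \]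
   Context: $G=\frac{\sqrt5+1}{2}$, $g=\frac{\sqrt5-1}{2}$. Every irrational $x>1$ has a unique odd continued fraction (OCF) expansion $x=a_1+\cfrac{e_1}{a_2+\cfrac{e_2}{a_3+\ddots}}=:[(a_1,e_1),(a_2,e_2),\dots]$ with $a_i$ odd positive integers, $e_i\in\{\pm1\}$, $a_i+e_i\ge2$. The numerators of the OCF convergents are defined by $p_0=1$, $p_1=a_1$, $p_n=a_np_{n-1}+e_{n-1}p_{n-2}$ ($n\ge2$), with the convention $e_0=1$. -}

module Defs where

open import Data.Nat as ℕ using (ℕ; zero; suc)
open import Data.Integer as ℤ using (ℤ; +_; -[1+_]; +[1+_])
open import Data.Rational as ℚ using (ℚ; _/_; 0ℚ; 1ℚ; floor)
open import Data.Product using (Σ; ∃; _×_; _,_)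
open import Data.Sum using (_⊎_)
open import Relation.Binary.PropositionalEquality using (_≡_)

Odd : ℕ → Set
Odd a = ∃ λ m → a ≡ suc (2 ℕ.* m)

-- Admissibility of an OCF digit sequence (a_i, e_i), i ≥ 1
-- (index 0 of a and e is unused): a_i odd positive, e_i ∈ {±1}, a_i + e_i ≥ 2.
AdmissibleOCF : (ℕ → ℕ) → (ℕ → ℤ) → Set
AdmissibleOCF a e =
  ∀ i → 1 ℕ.≤ i →
    Odd (a i) × (e i ≡ ℤ.1ℤ ⊎ e i ≡ ℤ.-1ℤ) × (ℤ.+ 2 ℤ.≤ (+ a i) ℤ.+ e i)

eC : (ℕ → ℤ) → ℕ → ℤ
eC e zero = ℤ.1ℤ
eC e (suc k) = e (suc k)

pOCF : (ℕ → ℕ) → (ℕ → ℤ) → ℕ → ℤ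
pOCF a e zero = ℤ.1ℤ
pOCF a e (suc zero) = + a 1
pOCF a e (suc (suc n)) =
  (+ a (suc (suc n))) ℤ.* pOCF a e (suc n) ℤ.+ eC e (suc n) ℤ.* pOCF a e n

-- The rational number P/Q (Q ≠ 0); the value for Q = 0 is an irrelevant default.
ratio : ℤ → ℤ → ℚ
ratio P (+ zero) = 0ℚ
ratio P +[1+ m ] = P / suc m
ratio P -[1+ m ] = (ℤ.- P) / suc m

-- Comparisons of a rational q with g = (√5 - 1)/2, the positive root of t² + t = 1.
-- g < q  ⇔  q > 0 and q² + q > 1 ;  q < g  ⇔  q ≤ 0 or q² + q < 1.
g<_ : ℚ → Set
g< q = (0ℚ ℚ.< q) × (1ℚ ℚ.< q ℚ.* q ℚ.+ q)

_<g : ℚ → Set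
q <g = (q ℚ.≤ 0ℚ) ⊎ (q ℚ.* q ℚ.+ q ℚ.< 1ℚ)

two* : ℕ → ℚ
two* k = + (2 ℕ.* k) / 1

F₁ : ℚ → Set
F₁ r = ∃ λ (k : ℕ) → g< (r ℚ.- two* k) × (r ℚ.< two* k ℚ.+ 1ℚ)

F₂ : ℚ → Set
F₂ r = ∃ λ (k : ℕ) → 1 ℕ.≤ k × (two* k ℚ.- 1ℚ ℚ.≤ r) × (r ℚ.< two* k)

F₃ : ℚ → Set
F₃ r = ∃ λ (k : ℕ) → 1 ℕ.≤ k × (two* k ℚ.≤ r) × ((r ℚ.- two* k) <g)

module Submission where

-- Write t_n = p_n / p_{n-1}, so that t_n = a_n + e_{n-1} / t_{n-1} (with 1 / t_0 = 0). By induction,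
-- t_n - (a_n - 1) > g: it is 1 for n = 1, at least 1 after a step with e = 1, and after a step
-- with e = -1 it is 1 - 1/t_{n-1} > g, because admissibility forces a_{n-1} ≥ 3, whence
-- t_{n-1} > 2 + g = G². Consequently, if e_{n-1} = 1 then 1/t_{n-1} < 1/g = G and t_n lies in
-- [a_n, a_n + 1) ⊂ F₂ or in [a_n + 1, a_n + 1 + g) ⊂ F₃, while if e_{n-1} = -1 then
-- 1/t_{n-1} < 1/G² = 1 - g and t_n lies in (a_n - 1 + g, a_n) ⊂ F₁. As a_n is odd, the parity of
-- ⌊t_n⌋ and the side of g on which t_n - ⌊t_n⌋ falls tell the three sets apart.
-- All comparisons with g are made on integers, using g² + g = 1.

open import Level using (0ℓ)
open import Data.Nat as ℕ using (ℕ; zero; suc; s≤s; z≤n; _∸_)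
import Data.Nat.Properties as ℕP
open import Data.Integer as ℤ using (ℤ; +_; +[1+_]; -[1+_]; _+_; _*_; _-_; -_; _<_; _≤_; 0ℤ; 1ℤ; -1ℤ)
import Data.Integer.Properties as ℤP
open import Data.Integer.DivMod using ([n/d]*d≤n; a≡a%n+[a/n]*n; n%d<d)
open import Data.Integer.Tactic.RingSolver using (solve; solve-∀)
open import Data.Rational as ℚ using (ℚ; _/_; toℚᵘ; floor; 1ℚ)
import Data.Rational.Properties as ℚP
open import Data.Rational.Unnormalised as ℚᵘ using (ℚᵘ; mkℚᵘ; _≃_; *≡*; *<*; *≤*)
import Data.Rational.Unnormalised.Properties as ℚᵘP
open import Data.List using (_∷_; [])
open import Data.Empty using (⊥)
open import Data.Product using (_×_; _,_; ∃; proj₁; proj₂)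
open import Data.Sum using (_⊎_; inj₁; inj₂)
open import Relation.Binary.Core using (Rel)
open import Relation.Binary.PropositionalEquality
open import Relation.Nullary using (yes; no; contradiction)
open import Defs

shift-by-difference : {_∼_ : Rel ℤ 0ℓ} → (∀ c {a b} → a ∼ b → (a + c) ∼ (b + c)) →
                      ∀ {a b c d} → a ∼ b → b - a ≡ d - c → c ∼ d
shift-by-difference {_∼_} +-monoˡ {a} {b} {c} {d} a∼b eq =
  subst₂ _∼_ a+[c-a]≡c b+[c-a]≡d (+-monoˡ (c - a) a∼b)
  where
  open ≡-Reasoning
  a+[c-a]≡c : a + (c - a) ≡ c
  a+[c-a]≡c = solve (a ∷ c ∷ [])
  b+[c-a]≡d : b + (c - a) ≡ d
  b+[c-a]≡d = begin
    b + (c - a) ≡⟨ solve (a ∷ b ∷ c ∷ []) ⟩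
    (b - a) + c ≡⟨ cong (_+ c) eq ⟩
    (d - c) + c ≡⟨ solve (c ∷ d ∷ []) ⟩
    d           ∎

<-by-difference : ∀ {a b c d} → a < b → b - a ≡ d - c → c < d
<-by-difference = shift-by-difference ℤP.+-monoˡ-<

≤-by-difference : ∀ {a b c d} → a ≤ b → b - a ≡ d - c → c ≤ d
≤-by-difference = shift-by-difference ℤP.+-monoˡ-≤

0≤i⇒0≤j⇒0≤i*j : ∀ {i j} → 0ℤ ≤ i → 0ℤ ≤ j → 0ℤ ≤ i * j
0≤i⇒0≤j⇒0≤i*j {i} {j} 0≤i 0≤j =
  subst (_≤ i * j) (ℤP.*-zeroʳ i) (ℤP.*-monoˡ-≤-nonNeg i {{ℤ.nonNegative 0≤i}} 0≤j)

0<+[1+_] : ∀ k → 0ℤ < + suc k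
0<+[1+ k ] = ℤ.+<+ (s≤s z≤n)

<+1⇒≤ : ∀ {i j} → i < j + 1ℤ → i ≤ j
<+1⇒≤ {i} {j} i<j+1 = ≤-by-difference (ℤP.i<j⇒suc[i]≤j i<j+1) eq
  where
  eq : j + 1ℤ - (1ℤ + i) ≡ j - i
  eq = solve (i ∷ j ∷ [])

i+1-1≡i : ∀ i → i + 1ℤ - 1ℤ ≡ i
i+1-1≡i = solve-∀

IsEven IsOdd : ℤ → Set
IsEven z = ∃ λ k → z ≡ + (2 ℕ.* k)
IsOdd z = ∃ λ k → z ≡ + suc (2 ℕ.* k)

even⇒¬odd : ∀ {z} → IsEven z → IsOdd z → ⊥
even⇒¬odd (k , refl) (j , eq) = ℕP.even≢odd k j (ℤP.+-injective eq)

+[2*suc]≡odd+1 : ∀ k → + (2 ℕ.* suc k) ≡ + suc (2 ℕ.* k) + 1ℤ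
+[2*suc]≡odd+1 k = cong +_ (trans (ℕP.*-suc 2 k) (ℕP.+-comm 1 (suc (2 ℕ.* k))))

-- U / Q > g and U / Q < g (for Q > 0), written as g< and <g are, via g² + g = 1.
record AboveG (U Q : ℤ) : Set where
  constructor aboveG
  field
    positive  : 0ℤ < U
    quadratic : Q * Q < U * U + U * Q

BelowG : ℤ → ℤ → Set
BelowG U Q = U ≤ 0ℤ ⊎ U * U + U * Q < Q * Q

aboveG-mono : ∀ {U V Q} → 0ℤ ≤ Q → AboveG U Q → U ≤ V → AboveG V Q
aboveG-mono {U} {V} {Q} 0≤Q (aboveG 0<U Q²<) U≤V =
  aboveG 0<V (ℤP.<-≤-trans Q²< (ℤP.+-mono-≤ U²≤V² UQ≤VQ))
  where
  0<V = ℤP.<-≤-trans 0<U U≤V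
  U²≤V² : U * U ≤ V * V
  U²≤V² = ℤP.≤-trans (ℤP.*-monoʳ-≤-nonNeg U {{ℤ.nonNegative (ℤP.<⇒≤ 0<U)}} U≤V)
                     (ℤP.*-monoˡ-≤-nonNeg V {{ℤ.nonNegative (ℤP.<⇒≤ 0<V)}} U≤V)
  UQ≤VQ : U * Q ≤ V * Q
  UQ≤VQ = ℤP.*-monoʳ-≤-nonNeg Q {{ℤ.nonNegative 0≤Q}} U≤V

aboveG-self : ∀ {Q} → 0ℤ < Q → AboveG Q Q
aboveG-self {Q} 0<Q =
  aboveG 0<Q (subst (_< Q * Q + Q * Q) (ℤP.+-identityʳ (Q * Q)) (ℤP.+-monoʳ-< (Q * Q) 0<Q²))
  where
  0<Q² : 0ℤ < Q * Q
  0<Q² = subst (_< Q * Q) (ℤP.*-zeroʳ Q) (ℤP.*-monoˡ-<-pos Q {{ℤ.positive 0<Q}} 0<Q)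

aboveG⇒¬belowG : ∀ {U Q} → AboveG U Q → BelowG U Q → ⊥
aboveG⇒¬belowG (aboveG 0<U _) (inj₁ U≤0) = ℤP.<⇒≱ 0<U U≤0
aboveG⇒¬belowG (aboveG _ Q²<) (inj₂ <Q²) = ℤP.<-asym Q²< <Q²

belowG⇒< : ∀ {U Q} → 0ℤ < Q → BelowG U Q → U < Q
belowG⇒< {U} {Q} 0<Q below with U ℤP.<? Q
... | yes U<Q = U<Q
... | no U≮Q = contradiction below
  (aboveG⇒¬belowG (aboveG-mono (ℤP.<⇒≤ 0<Q) (aboveG-self 0<Q) (ℤP.≮⇒≥ U≮Q)))

aboveG⇒belowG-inverse : ∀ {X Y} → AboveG X Y → BelowG (Y - X) X
aboveG⇒belowG-inverse {X} {Y} (aboveG _ Y²<) = inj₂ (<-by-difference Y²< (solve (X ∷ Y ∷ [])))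

-- Hypothesis and conclusion both amount to X² - 3XY + Y² > 0: for t = X / Y,
-- t - 2 > g and 1 - 1/t > g both say t > G².
aboveG-golden-square : ∀ {X Y} → 0ℤ < Y → AboveG (X - + 2 * Y) Y → AboveG (X - Y) X
aboveG-golden-square {X} {Y} 0<Y (aboveG 0<U Y²<) = aboveG
  (ℤP.<-trans 0<U (<-by-difference 0<Y (solve (X ∷ Y ∷ []))))
  (<-by-difference Y²< (solve (X ∷ Y ∷ [])))

IsFloor : ℤ → ℤ → ℤ → Set
IsFloor C P Q = C * Q ≤ P × P < (C + 1ℤ) * Q

isFloor-unique : ∀ {C C′ P Q} → 0ℤ < Q → IsFloor C P Q → IsFloor C′ P Q → C ≡ C′
isFloor-unique {Q = Q} 0<Q (CQ≤P , P<) (C′Q≤P , P<′) =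
  ℤP.≤-antisym (≤-of-bounds CQ≤P P<′) (≤-of-bounds C′Q≤P P<)
  where
  ≤-of-bounds : ∀ {C C′ P} → C * Q ≤ P → P < (C′ + 1ℤ) * Q → C ≤ C′
  ≤-of-bounds CQ≤P P< =
    <+1⇒≤ (ℤP.*-cancelʳ-<-nonNeg Q {{ℤ.nonNegative (ℤP.<⇒≤ 0<Q)}} (ℤP.≤-<-trans CQ≤P P<))

isFloor-div : ∀ n k → IsFloor (n ℤ./ + suc k) n (+ suc k)
isFloor-div n k = [n/d]*d≤n n (+ suc k) , n<
  where
  remainder<divisor : ∀ {ρ q d} → ρ < d → ρ + q * d < (q + 1ℤ) * d
  remainder<divisor {ρ} {q} {d} ρ<d = <-by-difference ρ<d (solve (ρ ∷ q ∷ d ∷ []))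
  n< : n < (n ℤ./ + suc k + 1ℤ) * + suc k
  n< = subst (_< (n ℤ./ + suc k + 1ℤ) * + suc k) (sym (a≡a%n+[a/n]*n n (+ suc k)))
         (remainder<divisor {q = n ℤ./ + suc k} (ℤ.+<+ (n%d<d n (+ suc k))))

isFloor-rescale : ∀ {C P Q P′ Q′} → 0ℤ < Q → 0ℤ < Q′ → P * Q′ ≡ P′ * Q →
                  IsFloor C P Q → IsFloor C P′ Q′
isFloor-rescale {C} {P} {Q} {P′} {Q′} 0<Q 0<Q′ eq (CQ≤P , P<) = CQ′≤P′ , P′<
  where
  open ℤP.≤-Reasoning
  CQ′≤P′ : C * Q′ ≤ P′
  CQ′≤P′ = ℤP.*-cancelʳ-≤-pos (C * Q′) P′ Q {{ℤ.positive 0<Q}} (begin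
    C * Q′ * Q ≡⟨ solve (C ∷ Q ∷ Q′ ∷ []) ⟩
    C * Q * Q′ ≤⟨ ℤP.*-monoʳ-≤-nonNeg Q′ {{ℤ.nonNegative (ℤP.<⇒≤ 0<Q′)}} CQ≤P ⟩
    P * Q′     ≡⟨ eq ⟩
    P′ * Q     ∎)
  P′< : P′ < (C + 1ℤ) * Q′
  P′< = ℤP.*-cancelʳ-<-nonNeg Q {{ℤ.nonNegative (ℤP.<⇒≤ 0<Q)}} (begin-strict
    P′ * Q            ≡⟨ eq ⟨
    P * Q′            <⟨ ℤP.*-monoʳ-<-pos Q′ {{ℤ.positive 0<Q′}} P< ⟩
    (C + 1ℤ) * Q * Q′ ≡⟨ solve (C ∷ Q ∷ Q′ ∷ []) ⟩
    (C + 1ℤ) * Q′ * Q ∎)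

remainder<⇒< : ∀ {C P Q} → P - C * Q < Q → P < (C + 1ℤ) * Q
remainder<⇒< {C} {P} {Q} U<Q = <-by-difference U<Q (solve (C ∷ P ∷ Q ∷ []))

isFloor-remainder : ∀ {C P Q} → 0ℤ ≤ P - C * Q → P - C * Q < Q → IsFloor C P Q
isFloor-remainder {C} 0≤U U<Q = ℤP.0≤i-j⇒j≤i 0≤U , remainder<⇒< {C} U<Q

floor-position-plus : ∀ {A Q R} → 0ℤ < Q → 0ℤ ≤ R → BelowG (R - Q) Q →
  IsFloor A (A * Q + R) Q ⊎ (IsFloor (A + 1ℤ) (A * Q + R) Q × BelowG (A * Q + R - (A + 1ℤ) * Q) Q)
floor-position-plus {A} {Q} {R} 0<Q 0≤R below with R ℤP.<? Q
... | yes R<Q = inj₁ (isFloor-remainder {A} {A * Q + R} {Q}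
  (≤-by-difference 0≤R (solve (A ∷ Q ∷ R ∷ []))) (<-by-difference R<Q (solve (A ∷ Q ∷ R ∷ []))))
... | no R≮Q = inj₂ (isFloor-remainder {A + 1ℤ} {A * Q + R} {Q}
  (≤-by-difference (ℤP.≮⇒≥ R≮Q) (solve (A ∷ Q ∷ R ∷ [])))
  (<-by-difference (belowG⇒< 0<Q below) (solve (A ∷ Q ∷ R ∷ []))) , subst (λ U → BelowG U Q) R-Q≡ below)
  where
  R-Q≡ : R - Q ≡ A * Q + R - (A + 1ℤ) * Q
  R-Q≡ = solve (A ∷ Q ∷ R ∷ [])

floor-position-minus : ∀ {A Q R} → 0ℤ < R → AboveG (Q - R) Q →
  IsFloor (A - 1ℤ) (A * Q - R) Q × AboveG (A * Q - R - (A - 1ℤ) * Q) Q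
floor-position-minus {A} {Q} {R} 0<R above@(aboveG 0<Q-R _) =
  isFloor-remainder {A - 1ℤ} {A * Q - R} {Q}
    (≤-by-difference (ℤP.<⇒≤ 0<Q-R) (solve (A ∷ Q ∷ R ∷ [])))
    (<-by-difference 0<R (solve (A ∷ Q ∷ R ∷ []))) ,
  subst (λ U → AboveG U Q) Q-R≡ above
  where
  Q-R≡ : Q - R ≡ A * Q - R - (A - 1ℤ) * Q
  Q-R≡ = solve (A ∷ Q ∷ R ∷ [])

-- With P = p_n, Q = p_{n-1} and A = a_n: p_n / p_{n-1} - (a_n - 1) > g.
record OCFInvariant (A P Q : ℤ) : Set where
  constructor invariant
  field
    denominator-positive : 0ℤ < Q
    above : AboveG (P - (A - 1ℤ) * Q) Q

invariant⇒aboveG : ∀ {A P Q} → 1ℤ ≤ A → OCFInvariant A P Q → AboveG P Q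
invariant⇒aboveG {A} {P} {Q} 1≤A (invariant 0<Q above) = aboveG-mono (ℤP.<⇒≤ 0<Q) above ≤P
  where
  ≤P : P - (A - 1ℤ) * Q ≤ P
  ≤P = ≤-by-difference (0≤i⇒0≤j⇒0≤i*j (ℤP.i≤j⇒0≤j-i 1≤A) (ℤP.<⇒≤ 0<Q))
                       (solve (A ∷ P ∷ Q ∷ []))

invariant⇒aboveG-remainder : ∀ {A P Q} → + 3 ≤ A → OCFInvariant A P Q → AboveG (P - Q) P
invariant⇒aboveG-remainder {A} {P} {Q} 3≤A (invariant 0<Q above) =
  aboveG-golden-square 0<Q (aboveG-mono (ℤP.<⇒≤ 0<Q) above ≤P-2Q)
  where
  ≤P-2Q : P - (A - 1ℤ) * Q ≤ P - + 2 * Q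
  ≤P-2Q = ≤-by-difference (0≤i⇒0≤j⇒0≤i*j (ℤP.i≤j⇒0≤j-i 3≤A) (ℤP.<⇒≤ 0<Q))
                          (solve (A ∷ P ∷ Q ∷ []))

invariant-base : ∀ A → OCFInvariant A A 1ℤ
invariant-base A = invariant 0<+[1+ 0 ] (subst (λ U → AboveG U 1ℤ) 1≡A-[A-1] (aboveG-self 0<+[1+ 0 ]))
  where
  1≡A-[A-1] : 1ℤ ≡ A - (A - 1ℤ) * 1ℤ
  1≡A-[A-1] = solve (A ∷ [])

invariant-step-plus : ∀ {A P Q E} A′ → E ≡ 1ℤ → 1ℤ ≤ A → OCFInvariant A P Q →
                      OCFInvariant A′ (A′ * P + E * Q) P
invariant-step-plus {A} {P} {Q} A′ refl 1≤A inv@(invariant 0<Q _) =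
  invariant 0<P (aboveG-mono (ℤP.<⇒≤ 0<P) (aboveG-self 0<P) P≤)
  where
  0<P = AboveG.positive (invariant⇒aboveG 1≤A inv)
  P≤ : P ≤ A′ * P + 1ℤ * Q - (A′ - 1ℤ) * P
  P≤ = ≤-by-difference (ℤP.<⇒≤ 0<Q) (solve (A′ ∷ P ∷ Q ∷ []))

invariant-step-minus : ∀ {A P Q E} A′ → E ≡ -1ℤ → + 3 ≤ A → OCFInvariant A P Q →
                       OCFInvariant A′ (A′ * P + E * Q) P
invariant-step-minus {A} {P} {Q} A′ refl 3≤A inv =
  invariant 0<P (subst (λ U → AboveG U P) P-Q≡ (invariant⇒aboveG-remainder 3≤A inv))
  where
  0<P = AboveG.positive (invariant⇒aboveG (ℤP.≤-trans (ℤ.+≤+ (s≤s z≤n)) 3≤A) inv)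
  P-Q≡ : P - Q ≡ A′ * P + -1ℤ * Q - (A′ - 1ℤ) * P
  P-Q≡ = solve (A′ ∷ P ∷ Q ∷ [])

toℚᵘ-ratio : ∀ P m → toℚᵘ (P / suc m) ≃ mkℚᵘ P m
toℚᵘ-ratio P m = ℚP.toℚᵘ-fromℚᵘ (mkℚᵘ P m)

toℚᵘ-plus-one : ∀ q {K} → toℚᵘ q ≃ mkℚᵘ K 0 → toℚᵘ (q ℚ.+ 1ℚ) ≃ mkℚᵘ (K + 1ℤ) 0
toℚᵘ-plus-one q {K} q≃K =
  ℚᵘP.≃-trans (ℚP.toℚᵘ-homo-+ q 1ℚ) (ℚᵘP.≃-trans (ℚᵘP.+-congˡ _ q≃K) (*≡* eq))
  where
  eq : (K * 1ℤ + 1ℤ * 1ℤ) * 1ℤ ≡ (K + 1ℤ) * 1ℤ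
  eq = solve (K ∷ [])

toℚᵘ-minus-one : ∀ q {K} → toℚᵘ q ≃ mkℚᵘ K 0 → toℚᵘ (q ℚ.- 1ℚ) ≃ mkℚᵘ (K - 1ℤ) 0
toℚᵘ-minus-one q {K} q≃K =
  ℚᵘP.≃-trans (ℚP.toℚᵘ-homo-+ q (ℚ.- 1ℚ)) (ℚᵘP.≃-trans (ℚᵘP.+-congˡ _ q≃K) (*≡* eq))
  where
  eq : (K * 1ℤ + -1ℤ * 1ℤ) * 1ℤ ≡ (K - 1ℤ) * 1ℤ
  eq = solve (K ∷ [])

toℚᵘ-sub : ∀ r q {P K m} → toℚᵘ r ≃ mkℚᵘ P m → toℚᵘ q ≃ mkℚᵘ K 0 →
           toℚᵘ (r ℚ.- q) ≃ mkℚᵘ (P - K * + suc m) m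
toℚᵘ-sub r q {P} {K} {m} r≃P q≃K = ℚᵘP.≃-trans (ℚP.toℚᵘ-homo-+ r (ℚ.- q))
  (ℚᵘP.≃-trans (ℚᵘP.+-cong r≃P (ℚᵘP.≃-trans (ℚP.toℚᵘ-homo‿- q) (ℚᵘP.-‿cong q≃K)))
                (*≡* eq))
  where
  rearrange : ∀ P K Q → (P * 1ℤ + - K * Q) * Q ≡ (P - K * Q) * Q
  rearrange = solve-∀
  eq : (P * 1ℤ + - K * + suc m) * + suc m ≡ (P - K * + suc m) * + (suc m ℕ.* 1)
  eq = trans (rearrange P K (+ suc m)) (cong (λ d → (P - K * + suc m) * + d) (sym (ℕP.*-identityʳ (suc m))))

floor-unique : ∀ r {C P m} → toℚᵘ r ≃ mkℚᵘ P m → IsFloor C P (+ suc m) → floor r ≡ C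
floor-unique (ℚ.mkℚ n k _) {C} {P} {m} (*≡* eq) isFloor = isFloor-unique 0<+[1+ k ] (isFloor-div n k)
  (isFloor-rescale {C} {P} {+ suc m} {n} {+ suc k} 0<+[1+ m ] 0<+[1+ k ] (sym eq) isFloor)

module _ {r : ℚ} {P : ℤ} {m : ℕ} (r≃P : toℚᵘ r ≃ mkℚᵘ P m) where

  private
    Q : ℤ
    Q = + suc m
    x : ℚᵘ
    x = mkℚᵘ P m

    r²+r≃x²+x : toℚᵘ (r ℚ.* r ℚ.+ r) ≃ x ℚᵘ.* x ℚᵘ.+ x
    r²+r≃x²+x = ℚᵘP.≃-trans (ℚP.toℚᵘ-homo-+ (r ℚ.* r) r)
      (ℚᵘP.+-cong (ℚᵘP.≃-trans (ℚP.toℚᵘ-homo-* r r) (ℚᵘP.*-cong r≃P r≃P)) r≃P)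

    numerator : ℚᵘ.↥ (x ℚᵘ.* x ℚᵘ.+ x) ≡ Q * (P * P + P * Q)
    numerator = trans (cong (λ z → P * P * Q + P * z) (ℤP.pos-* (suc m) (suc m))) (factor P Q)
      where
      factor : ∀ P Q → P * P * Q + P * (Q * Q) ≡ Q * (P * P + P * Q)
      factor = solve-∀

    denominator : ℚᵘ.↧ (x ℚᵘ.* x ℚᵘ.+ x) ≡ Q * (Q * Q)
    denominator = trans (ℤP.pos-* (suc m ℕ.* suc m) (suc m))
      (trans (cong (_* Q) (ℤP.pos-* (suc m) (suc m))) (ℤP.*-comm (Q * Q) Q))

  <⇒<-numerator : ∀ {q K} → toℚᵘ q ≃ mkℚᵘ K 0 → r ℚ.< q → P < K * Q
  <⇒<-numerator q≃K r<q with ℚᵘP.<-respʳ-≃ q≃K (ℚᵘP.<-respˡ-≃ r≃P (ℚP.toℚᵘ-mono-< r<q))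
  ... | *<* P*1<K*Q = subst (_< _) (ℤP.*-identityʳ P) P*1<K*Q

  ≤⇒≤-numerator : ∀ {q K} → toℚᵘ q ≃ mkℚᵘ K 0 → q ℚ.≤ r → K * Q ≤ P
  ≤⇒≤-numerator q≃K q≤r with ℚᵘP.≤-respˡ-≃ q≃K (ℚᵘP.≤-respʳ-≃ r≃P (ℚP.toℚᵘ-mono-≤ q≤r))
  ... | *≤* K*Q≤P*1 = subst (_ ≤_) (ℤP.*-identityʳ P) K*Q≤P*1

  g<⇒aboveG : g< r → AboveG P Q
  g<⇒aboveG (0<r , 1<r²+r) = aboveG 0<P Q²<P²+PQ
    where
    0<P : 0ℤ < P
    0<P with ℚᵘP.<-respʳ-≃ r≃P (ℚP.toℚᵘ-mono-< 0<r)
    ... | *<* 0*Q<P*1 = subst₂ _<_ (ℤP.*-zeroˡ Q) (ℤP.*-identityʳ P) 0*Q<P*1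
    Q²<P²+PQ : Q * Q < P * P + P * Q
    Q²<P²+PQ with ℚᵘP.<-respʳ-≃ r²+r≃x²+x (ℚP.toℚᵘ-mono-< 1<r²+r)
    ... | *<* h = ℤP.*-cancelˡ-<-nonNeg Q
      (subst₂ _<_ (trans (ℤP.*-identityˡ _) denominator) (trans (ℤP.*-identityʳ _) numerator) h)

  <g⇒belowG : r <g → BelowG P Q
  <g⇒belowG (inj₁ r≤0) with ℚᵘP.≤-respˡ-≃ r≃P (ℚP.toℚᵘ-mono-≤ r≤0)
  ... | *≤* P*1≤0*Q = inj₁ (subst₂ _≤_ (ℤP.*-identityʳ P) (ℤP.*-zeroˡ Q) P*1≤0*Q)
  <g⇒belowG (inj₂ r²+r<1) with ℚᵘP.<-respˡ-≃ r²+r≃x²+x (ℚP.toℚᵘ-mono-< r²+r<1)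
  ... | *<* h = inj₂ (ℤP.*-cancelˡ-<-nonNeg Q
      (subst₂ _<_ (trans (ℤP.*-identityʳ _) numerator) (trans (ℤP.*-identityˡ _) denominator) h))

DigitRule : ℚ → ℕ → ℤ → Set
DigitRule r a E =
  (F₁ r → (+ a ≡ floor r + 1ℤ) × (E ≡ -1ℤ)) ×
  (F₂ r → (+ a ≡ floor r) × (E ≡ 1ℤ)) ×
  (F₃ r → (+ a ≡ floor r - 1ℤ) × (E ≡ 1ℤ))

module _ {r : ℚ} {P : ℤ} {m : ℕ} (r≃P : toℚᵘ r ≃ mkℚᵘ P m) where

  private
    Q : ℤ
    Q = + suc m

  F₁⇒floor : F₁ r → IsEven (floor r) × AboveG (P - floor r * Q) Q
  F₁⇒floor (k , g<r-2k , r<2k+1) =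
    (k , floor≡K) , subst (λ C → AboveG (P - C * Q) Q) (sym floor≡K) above
    where
    K = + (2 ℕ.* k)
    above : AboveG (P - K * Q) Q
    above = g<⇒aboveG (toℚᵘ-sub r (two* k) r≃P (toℚᵘ-ratio K 0)) g<r-2k
    floor≡K : floor r ≡ K
    floor≡K = floor-unique r r≃P (ℤP.0≤i-j⇒j≤i (ℤP.<⇒≤ (AboveG.positive above)) ,
                                  <⇒<-numerator r≃P (toℚᵘ-plus-one (two* k) (toℚᵘ-ratio K 0)) r<2k+1)

  F₂⇒floor : F₂ r → IsOdd (floor r)
  F₂⇒floor (suc k , _ , 2k-1≤r , r<2k) = k , floor-unique r r≃P (BQ≤P , P<[B+1]Q)
    where
    K = + (2 ℕ.* suc k)
    B = + suc (2 ℕ.* k)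
    BQ≤P : B * Q ≤ P
    BQ≤P = subst (λ C → C * Q ≤ P) (trans (cong (_- 1ℤ) (+[2*suc]≡odd+1 k)) (i+1-1≡i B))
      (≤⇒≤-numerator r≃P (toℚᵘ-minus-one (two* (suc k)) (toℚᵘ-ratio K 0)) 2k-1≤r)
    P<[B+1]Q : P < (B + 1ℤ) * Q
    P<[B+1]Q = subst (λ C → P < C * Q) (+[2*suc]≡odd+1 k) (<⇒<-numerator r≃P (toℚᵘ-ratio K 0) r<2k)

  F₃⇒floor : F₃ r → IsEven (floor r) × BelowG (P - floor r * Q) Q
  F₃⇒floor (k , _ , 2k≤r , r-2k<g) =
    (k , floor≡K) , subst (λ C → BelowG (P - C * Q) Q) (sym floor≡K) below
    where
    K = + (2 ℕ.* k)
    below : BelowG (P - K * Q) Q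
    below = <g⇒belowG (toℚᵘ-sub r (two* k) r≃P (toℚᵘ-ratio K 0)) r-2k<g
    floor≡K : floor r ≡ K
    floor≡K = floor-unique r r≃P (≤⇒≤-numerator r≃P (toℚᵘ-ratio K 0) 2k≤r ,
                                  remainder<⇒< {K} (belowG⇒< 0<+[1+ m ] below))

  digitRule-odd-floor : ∀ j → floor r ≡ + suc (2 ℕ.* j) → DigitRule r (suc (2 ℕ.* j)) 1ℤ
  digitRule-odd-floor j floor≡A =
    (λ r∈F₁ → contradiction odd (even⇒¬odd (proj₁ (F₁⇒floor r∈F₁)))) ,
    (λ _ → sym floor≡A , refl) ,
    (λ r∈F₃ → contradiction odd (even⇒¬odd (proj₁ (F₃⇒floor r∈F₃))))
    where
    odd : IsOdd (floor r)
    odd = j , floor≡A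

  digitRule-even-floor-below : ∀ j → floor r ≡ + suc (2 ℕ.* j) + 1ℤ → BelowG (P - floor r * Q) Q →
                               DigitRule r (suc (2 ℕ.* j)) 1ℤ
  digitRule-even-floor-below j floor≡A+1 below =
    (λ r∈F₁ → contradiction below (aboveG⇒¬belowG (proj₂ (F₁⇒floor r∈F₁)))) ,
    (λ r∈F₂ → contradiction (F₂⇒floor r∈F₂)
                (even⇒¬odd (suc j , trans floor≡A+1 (sym (+[2*suc]≡odd+1 j))))) ,
    (λ _ → sym (trans (cong (_- 1ℤ) floor≡A+1) (i+1-1≡i _)) , refl)

  digitRule-even-floor-above : ∀ j → floor r ≡ + (2 ℕ.* j) → AboveG (P - floor r * Q) Q →
                               DigitRule r (suc (2 ℕ.* j)) -1ℤ
  digitRule-even-floor-above j floor≡A-1 above =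
    (λ _ → trans (cong +_ (ℕP.+-comm 1 (2 ℕ.* j))) (cong (_+ 1ℤ) (sym floor≡A-1)) , refl) ,
    (λ r∈F₂ → contradiction (F₂⇒floor r∈F₂) (even⇒¬odd (j , floor≡A-1))) ,
    (λ r∈F₃ → contradiction (proj₂ (F₃⇒floor r∈F₃)) (aboveG⇒¬belowG above))

digitRule-plus : ∀ {a E P Q R} → Odd a → E ≡ 1ℤ → 0ℤ < Q → 0ℤ ≤ R → BelowG (R - Q) Q →
                 P ≡ + a * Q + E * R → DigitRule (ratio P Q) a E
digitRule-plus {Q = +[1+ m ]} {R} (j , refl) refl _ 0≤R below refl rewrite ℤP.*-identityˡ R
  with floor-position-plus {+ suc (2 ℕ.* j)} 0<+[1+ m ] 0≤R below
... | inj₁ isFloor = digitRule-odd-floor r≃P j (floor-unique _ r≃P isFloor)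
  where
  r≃P = toℚᵘ-ratio (+ suc (2 ℕ.* j) * +[1+ m ] + R) m
... | inj₂ (isFloor , below′) =
  digitRule-even-floor-below r≃P j floor≡ (subst (λ C → BelowG (P - C * Q) Q) (sym floor≡) below′)
  where
  Q = +[1+ m ]
  P = + suc (2 ℕ.* j) * Q + R
  r≃P = toℚᵘ-ratio P m
  floor≡ = floor-unique _ r≃P isFloor
digitRule-plus {Q = + zero} _ _ (ℤ.+<+ ()) _ _ _
digitRule-plus {Q = -[1+ _ ]} _ _ () _ _ _

digitRule-minus : ∀ {a E P Q R} → Odd a → E ≡ -1ℤ → 0ℤ < Q → 0ℤ < R → AboveG (Q - R) Q →
                  P ≡ + a * Q + E * R → DigitRule (ratio P Q) a E
digitRule-minus {Q = +[1+ m ]} {R} (j , refl) refl _ 0<R above refl rewrite ℤP.-1*i≡-i R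
  with floor-position-minus {+ suc (2 ℕ.* j)} 0<R above
... | isFloor , above′ =
  digitRule-even-floor-above r≃P j floor≡ (subst (λ C → AboveG (P - C * Q) Q) (sym floor≡) above′)
  where
  Q = +[1+ m ]
  P = + suc (2 ℕ.* j) * Q - R
  r≃P = toℚᵘ-ratio P m
  floor≡ = floor-unique _ r≃P isFloor
digitRule-minus {Q = + zero} _ _ (ℤ.+<+ ()) _ _ _
digitRule-minus {Q = -[1+ _ ]} _ _ () _ _ _

odd⇒1≤ : ∀ {a} → Odd a → 1ℤ ≤ + a
odd⇒1≤ (_ , refl) = ℤ.+≤+ (s≤s z≤n)

3≤digit : ∀ {A E} → E ≡ -1ℤ → + 2 ≤ A + E → + 3 ≤ A
3≤digit {A} refl 2≤A-1 = ≤-by-difference 2≤A-1 (solve (A ∷ []))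

ocf-invariant : ∀ a e → AdmissibleOCF a e → ∀ n → OCFInvariant (+ a (suc n)) (pOCF a e (suc n)) (pOCF a e n)
ocf-invariant a e admissible zero = invariant-base (+ a 1)
ocf-invariant a e admissible (suc n) with admissible (suc n) (s≤s z≤n)
... | odd , inj₁ e≡1 , _ = invariant-step-plus _ e≡1 (odd⇒1≤ odd) (ocf-invariant a e admissible n)
... | _ , inj₂ e≡-1 , 2≤a+e =
  invariant-step-minus _ e≡-1 (3≤digit e≡-1 2≤a+e) (ocf-invariant a e admissible n)

lemma8 : (a : ℕ → ℕ) (e : ℕ → ℤ) → AdmissibleOCF a e → (n : ℕ) → 1 ℕ.≤ n →
    let r = ratio (pOCF a e n) (pOCF a e (n ∸ 1)) in
    (F₁ r → (+ a n ≡ floor r + 1ℤ) × (eC e (n ∸ 1) ≡ -1ℤ)) ×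
    (F₂ r → (+ a n ≡ floor r) × (eC e (n ∸ 1) ≡ 1ℤ)) ×
    (F₃ r → (+ a n ≡ floor r - 1ℤ) × (eC e (n ∸ 1) ≡ 1ℤ))
lemma8 a e admissible (suc zero) _ =
  digitRule-plus (proj₁ (admissible 1 (s≤s z≤n))) refl 0<+[1+ 0 ] ℤP.≤-refl (inj₁ ℤ.-≤+)
    (sym a₁*1+0≡a₁)
  where
  a₁*1+0≡a₁ : + a 1 * 1ℤ + 0ℤ ≡ + a 1
  a₁*1+0≡a₁ = trans (ℤP.+-identityʳ _) (ℤP.*-identityʳ _)
lemma8 a e admissible (suc (suc n)) _ with admissible (suc (suc n)) (s≤s z≤n) | admissible (suc n) (s≤s z≤n)
... | odd , _ | odd′ , inj₁ e≡1 , _ =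
  digitRule-plus odd e≡1 (AboveG.positive above) (ℤP.<⇒≤ (OCFInvariant.denominator-positive inv))
    (aboveG⇒belowG-inverse above) refl
  where
  inv = ocf-invariant a e admissible n
  above = invariant⇒aboveG (odd⇒1≤ odd′) inv
... | odd , _ | odd′ , inj₂ e≡-1 , 2≤a+e =
  digitRule-minus odd e≡-1 (AboveG.positive (invariant⇒aboveG (odd⇒1≤ odd′) inv))
    (OCFInvariant.denominator-positive inv) (invariant⇒aboveG-remainder (3≤digit e≡-1 2≤a+e) inv) refl
  where
  inv = ocf-invariant a e admissible n
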